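{- Let $b\geq 1$ and $L\geq 1$ be integers and let $s\in\mathcal{S}_L$. Then $s$ has a cycle (in its cycle decomposition, fixed points counted as cycles of length $1$) of length at least $b+1$ if and only if the permutation $F(s)$ has a $b$-anomaly.
   Context: $\mathcal{S}_L$ denotes the group of permutations of $\{1,\ldots,L\}$. A permutation $s$ is represented by the word $s(1)s(2)\cdots s(L)$. The Foata correspondence $F:\mathcal{S}_L\to\mathcal{S}_L$ is defined as follows: write the cycle decomposition of $s$ (including fixed points as cycles of length $1$) so that each cycle starts with its largest element (the cycle head), and list the cycles in increasing order of their cycle heads; then remove the brackets. The resulting word of $L$ distinct letters in $\{1,\ldots,L\}$ is $F(s)$. For example, if $s=359724681$, its cycles are written $[52][764][8][913]$ and $F(s)=527648913$. Given a permutation written as a word $a_1\cdots a_L$ and an integer $b\geq 1$, a consecutive subword $a_{i+1}\cdots a_{i+b}$ is called a $b$-anomaly if there exists $1\leq j\leq i$ with $a_j>\max(a_{i+1},\ldots,a_{i+b})$. -}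

module Defs where

open import Data.Nat using (ℕ; zero; suc; _+_)
open import Data.Bool using (Bool; true; false; if_then_else_; _∧_)
open import Data.Fin using (Fin; _<_; _≤?_; _≟_)
open import Data.Fin.Permutation using (Permutation′; _⟨$⟩ʳ_)
open import Data.List using (List; []; _∷_; _++_; length; upTo; allFin; filter; concatMap; map)
open import Data.Bool.ListAction using (and)
open import Data.List.Relation.Unary.All using (All)
open import Data.List.Membership.Propositional using (_∈_)
open import Data.Product using (Σ; _×_; ∃; ∃-syntax)
open import Relation.Binary.PropositionalEquality using (_≡_; _≢_)
open import Relation.Nullary.Decidable using (⌊_⌋; T?)

-- Elements of Fin L represent 1,…,L (order preserving: i ↦ toℕ i + 1).

iter : ∀ {L} → Permutation′ L → ℕ → Fin L → Fin L
iter s zero    x = x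
iter s (suc k) x = s ⟨$⟩ʳ (iter s k x)

OnCycleOfLength : ∀ {L} → Permutation′ L → Fin L → ℕ → Set
OnCycleOfLength s x k =
  (0 Data.Nat.< k) × (iter s k x ≡ x) × (∀ j → 0 Data.Nat.< j → j Data.Nat.< k → iter s j x ≢ x)

HasCycleOfLengthAtLeast : ∀ {L} → Permutation′ L → ℕ → Set
HasCycleOfLengthAtLeast {L} s m = ∃[ x ] ∃[ k ] (m Data.Nat.≤ k × OnCycleOfLength s x k)

-- h is a cycle head: the largest element of its cycle
-- (every orbit has size ≤ L, so checking s^k h ≤ h for k < L suffices).
isHead : ∀ {L} → Permutation′ L → Fin L → Bool
isHead {L} s h = and (map (λ k → ⌊ iter s k h ≤? h ⌋) (upTo L))

-- the cycle of s written starting at h: h, s h, s² h, … until returning to h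
-- (fuel argument; fuel L is always enough)
cycleFrom : ∀ {L} → Permutation′ L → Fin L → ℕ → Fin L → List (Fin L)
cycleFrom s h zero    x = []
cycleFrom s h (suc n) x =
  x ∷ (if ⌊ s ⟨$⟩ʳ x ≟ h ⌋ then [] else cycleFrom s h n (s ⟨$⟩ʳ x))

-- Foata correspondence: cycles started at their heads, heads listed in
-- increasing order (allFin L is increasing), brackets removed.
foata : ∀ {L} → Permutation′ L → List (Fin L)
foata {L} s = concatMap (λ h → cycleFrom s h L h) (filter (λ h → T? (isHead s h)) (allFin L))

HasAnomaly : ∀ {L} → ℕ → List (Fin L) → Set
HasAnomaly {L} b w =
  ∃[ p ] ∃[ m ] ∃[ q ] (w ≡ p ++ m ++ q × length m ≡ b ×
    ∃[ a ] (a ∈ p × All (_< a) m))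

module Submission where

-- F(s) = foata s is the concatenation of the blocks "cycle of h, written from h",
-- one for each cycle head h, in increasing order of heads.  We call such a list of
-- blocks a block list: every block is a head followed by smaller letters, and the
-- heads strictly increase.  The proof has two halves, joined by this shape:
--
--  * Words.  In the concatenation of a block list, a b-anomaly (b ≥ 1) exists iff
--    some block is longer than b.  A letter a before the window that exceeds the
--    whole window is at most the head h of the block where the window starts,
--    while the next head is larger than h, so the window never reaches the next
--    block and fits in one block.  Conversely, in a long block h t the letter h
--    followed by the first b letters of t is a b-anomaly.
--  * Permutations.  The block of h runs along the orbit of h until it returns to h.
--    So a long block gives a long cycle; and the largest element h of a long
--    cycle is a cycle head whose block covers the whole cycle.

open import Defs
open import Data.Nat using (ℕ; _≤_; _+_)
open import Data.Fin.Permutation using (Permutation′)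
open import Function.Bundles using (_⇔_)

open import Data.Nat as ℕ using (zero; suc; z≤n; s≤s; _∸_)
import Data.Nat.Properties as ℕP
open import Data.Nat.Induction using (<-rec)
open import Data.Fin as F using (Fin; toℕ)
import Data.Fin.Properties as FP
open import Data.Fin.Permutation using (_⟨$⟩ʳ_; _⟨$⟩ˡ_; inverseˡ)
open import Data.List using (List; []; _∷_; _++_; [_]; length; concat; map; filter; allFin; upTo; take; drop)
open import Data.List.Properties using (++-assoc; ∷-injective; ∷-injectiveˡ; length-++; length-take; take++drop≡id)
open import Data.List.Relation.Unary.All as All using (All; []; _∷_)
import Data.List.Relation.Unary.All.Properties as AllP
open import Data.List.Relation.Unary.Any using (here; there)
open import Data.List.Relation.Unary.AllPairs using (AllPairs; []; _∷_)
import Data.List.Relation.Unary.AllPairs.Properties as AllPairsP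
open import Data.List.Membership.Propositional using (_∈_)
open import Data.List.Membership.Propositional.Properties
  using (∈-++⁺ˡ; ∈-++⁺ʳ; ∈-++⁻; ∈-map⁺; ∈-map⁻; ∈-upTo⁺; ∈-filter⁺; ∈-filter⁻; ∈-allFin)
import Data.List.Extrema
open import Data.Product using (∃₂; ∃-syntax; _×_; _,_; proj₁; proj₂)
open import Data.Sum using (_⊎_; inj₁; inj₂; [_,_]′)
open import Data.Empty using (⊥; ⊥-elim)
open import Data.Bool using (Bool; T)
open import Relation.Binary.PropositionalEquality using (_≡_; _≢_; refl; sym; trans; cong; subst; module ≡-Reasoning)
open import Relation.Nullary using (¬_; Dec; yes; no)
open import Relation.Nullary.Decidable using (⌊_⌋; T?; toWitness; fromWitness)
open import Function.Base using (_∘_)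
open import Function.Bundles using (mk⇔; Equivalence)
import Function.Properties.Equivalence as ⇔

open Equivalence using (to; from)

least-witness : ∀ {P : ℕ → Set} → (∀ n → Dec (P n)) → ∀ n → P n →
  ∃[ k ] (P k × ∀ j → j ℕ.< k → ¬ P j)
least-witness {P} P? = <-rec (λ n → P n → ∃[ k ] (P k × ∀ j → j ℕ.< k → ¬ P j)) search
  where
  search : ∀ n → (∀ {m} → m ℕ.< n → P m → ∃[ k ] (P k × ∀ j → j ℕ.< k → ¬ P j)) →
    P n → ∃[ k ] (P k × ∀ j → j ℕ.< k → ¬ P j)
  search n smaller Pn with ℕP.anyUpTo? P? n
  ... | yes (j , j<n , Pj) = smaller j<n Pj
  ... | no none = n , Pn , λ j j<n Pj → none (j , j<n , Pj)

++-meet : ∀ {A : Set} (t r p w : List A) → t ++ r ≡ p ++ w →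
  (∃[ u ] (p ≡ t ++ u × r ≡ u ++ w)) ⊎ (∃[ u ] (t ≡ p ++ u × u ++ r ≡ w))
++-meet []      r p       w e = inj₁ (p , refl , e)
++-meet (x ∷ t) r []      w e = inj₂ (x ∷ t , refl , e)
++-meet (x ∷ t) r (y ∷ p) w e with ∷-injective e
... | refl , e′ with ++-meet t r p w e′
...   | inj₁ (u , refl , e″) = inj₁ (u , refl , e″)
...   | inj₂ (u , refl , e″) = inj₂ (u , refl , e″)

fits-or-overflows : ∀ {A : Set} (u r m q : List A) → u ++ r ≡ m ++ q →
  length m ≤ length u ⊎ ∃₂ λ z zs → r ≡ z ∷ zs × z ∈ m
fits-or-overflows []      r []      q e = inj₁ z≤n
fits-or-overflows []      r (y ∷ m) q e = inj₂ (y , m ++ q , e , here refl)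
fits-or-overflows (x ∷ u) r []      q e = inj₁ z≤n
fits-or-overflows (x ∷ u) r (y ∷ m) q e with fits-or-overflows u r m q (proj₂ (∷-injective e))
... | inj₁ m≤u                = inj₁ (s≤s m≤u)
... | inj₂ (z , zs , e′ , z∈m) = inj₂ (z , zs , e′ , there z∈m)

∈⇒concat-infix : ∀ {A : Set} {B : List A} {Bs : List (List A)} → B ∈ Bs →
  ∃₂ λ P Q → concat Bs ≡ P ++ B ++ Q
∈⇒concat-infix {Bs = B ∷ Bs} (here refl) = [] , concat Bs , refl
∈⇒concat-infix {Bs = C ∷ Bs} (there B∈Bs) with ∈⇒concat-infix B∈Bs
... | P , Q , e = C ++ P , Q , trans (cong (C ++_) e) (sym (++-assoc C P _))

module _ {L : ℕ} where

  _⊏_ : Fin L → List (Fin L) → Set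
  a ⊏ []      = ⊥
  a ⊏ (h ∷ _) = a F.< h

  data BlockList : List (List (Fin L)) → Set where
    []    : BlockList []
    block : ∀ {h t Bs} → All (F._< h) t → All (h ⊏_) Bs → BlockList Bs →
            BlockList ((h ∷ t) ∷ Bs)

  HasLongBlock : ℕ → List (List (Fin L)) → Set
  HasLongBlock b Bs = ∃[ B ] (B ∈ Bs × b ℕ.< length B)

  ⊏-weaken : ∀ {a h : Fin L} {B} → a F.≤ h → h ⊏ B → a ⊏ B
  ⊏-weaken {B = _ ∷ _} a≤h h<h′ = ℕP.≤-<-trans a≤h h<h′

  concat-first : ∀ {a z : Fin L} {zs Bs} → All (a ⊏_) Bs → concat Bs ≡ z ∷ zs → a F.< z
  concat-first {Bs = (h ∷ t) ∷ _} (a<h ∷ _) e = subst (_ F.<_) (∷-injectiveˡ e) a<h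

  witness-vs-head : ∀ {a h : Fin L} {t p Bs} →
    a ∈ h ∷ p ⊎ All (a ⊏_) ((h ∷ t) ∷ Bs) → a F.≤ h ⊎ a ∈ p
  witness-vs-head (inj₁ (here refl))  = inj₁ FP.≤-refl
  witness-vs-head (inj₁ (there a∈p))  = inj₂ a∈p
  witness-vs-head (inj₂ (a<h ∷ _))    = inj₁ (ℕP.<⇒≤ a<h)

  witness-after-block : ∀ {a h : Fin L} {t u Bs} → All (F._< h) t → All (h ⊏_) Bs →
    a F.≤ h ⊎ a ∈ t ++ u → a ∈ u ⊎ All (a ⊏_) Bs
  witness-after-block t<h h⊏Bs (inj₁ a≤h) = inj₂ (All.map (⊏-weaken a≤h) h⊏Bs)
  witness-after-block {t = t} t<h h⊏Bs (inj₂ a∈tu) with ∈-++⁻ t a∈tu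
  ... | inj₁ a∈t = inj₂ (All.map (⊏-weaken (ℕP.<⇒≤ (All.lookup t<h a∈t))) h⊏Bs)
  ... | inj₂ a∈u = inj₁ a∈u

  window-in-block : ∀ {Bs : List (List (Fin L))} {a} p m q → BlockList Bs →
    concat Bs ≡ p ++ m ++ q → 0 ℕ.< length m → All (F._< a) m → a ∈ p ⊎ All (a ⊏_) Bs →
    HasLongBlock (length m) Bs
  window-in-block []      []      q _   _  () _ _
  window-in-block []      (z ∷ m) q []  () _  _ _
  window-in-block (y ∷ p) m       q []  () _  _ _
  window-in-block []      (z ∷ m) q (block _ _ _) e _ (z<a ∷ _) (inj₂ (a<h ∷ _)) =
    ⊥-elim (ℕP.<-asym (subst (F._< _) (sym (∷-injectiveˡ e)) z<a) a<h)
  window-in-block {(h ∷ t) ∷ Bs} (y ∷ p) m q (block t<h h⊏Bs blocks) e 0<m m<a early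
    with ∷-injective e
  ... | refl , e′ with witness-vs-head {t = t} early | ++-meet t (concat Bs) p (m ++ q) e′
  ...   | a≤h⊎a∈p | inj₁ (u , refl , e″)
          with window-in-block u m q blocks e″ 0<m m<a (witness-after-block t<h h⊏Bs a≤h⊎a∈p)
  ...     | B , B∈Bs , long = B , there B∈Bs , long
  window-in-block {(h ∷ t) ∷ Bs} {a} (y ∷ p) m q (block t<h h⊏Bs blocks) e 0<m m<a early
      | refl , e′ | a≤h⊎a∈p | inj₂ (u , refl , e″) with fits-or-overflows u (concat Bs) m q e″
  ...     | inj₁ m≤u = h ∷ p ++ u , here refl ,
            s≤s (ℕP.≤-trans m≤u (subst (length u ≤_) (sym (length-++ p)) (ℕP.m≤n+m _ _)))
  ...     | inj₂ (z , zs , r≡z∷zs , z∈m) =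
            ⊥-elim (ℕP.<⇒≱ (ℕP.<-trans (concat-first h⊏Bs r≡z∷zs) (All.lookup m<a z∈m)) a≤h)
    where
    a≤h : a F.≤ h
    a≤h = [ (λ a≤h → a≤h) , (λ a∈p → ℕP.<⇒≤ (All.lookup t<h (∈-++⁺ˡ a∈p))) ]′ a≤h⊎a∈p

  -- A block h ∷ t inside a word, with b ≤ |t|, yields the b-anomaly
  -- "h, then the first b letters of t".
  block-anomaly : ∀ {h : Fin L} {t} b P Q → All (F._< h) t → b ≤ length t →
    HasAnomaly b (P ++ (h ∷ t) ++ Q)
  block-anomaly {h} {t} b P Q t<h b≤t =
    P ++ [ h ] , take b t , drop b t ++ Q , factorisation ,
    trans (length-take b t) (ℕP.m≤n⇒m⊓n≡m b≤t) ,
    h , ∈-++⁺ʳ P (here refl) , AllP.take⁺ b t<h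
    where
    open ≡-Reasoning
    factorisation : P ++ (h ∷ t) ++ Q ≡ (P ++ [ h ]) ++ take b t ++ drop b t ++ Q
    factorisation = begin
      P ++ h ∷ t ++ Q                          ≡⟨ cong (λ v → P ++ h ∷ v ++ Q) (sym (take++drop≡id b t)) ⟩
      P ++ h ∷ (take b t ++ drop b t) ++ Q     ≡⟨ cong (λ v → P ++ h ∷ v) (++-assoc (take b t) (drop b t) Q) ⟩
      P ++ [ h ] ++ take b t ++ drop b t ++ Q  ≡⟨ sym (++-assoc P [ h ] _) ⟩
      (P ++ [ h ]) ++ take b t ++ drop b t ++ Q ∎

  member-block : ∀ {Bs B} → BlockList Bs → B ∈ Bs → ∃₂ λ h t → B ≡ h ∷ t × All (F._< h) t
  member-block (block t<h _ _)  (here refl)  = _ , _ , refl , t<h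
  member-block (block _ _ blocks) (there B∈Bs) = member-block blocks B∈Bs

  anomaly⇔long-block : ∀ {b Bs} → 1 ≤ b → BlockList Bs →
    HasAnomaly b (concat Bs) ⇔ HasLongBlock b Bs
  anomaly⇔long-block {b} {Bs} 1≤b blocks = mk⇔ anomaly⇒long long⇒anomaly
    where
    anomaly⇒long : HasAnomaly b (concat Bs) → HasLongBlock b Bs
    anomaly⇒long (p , m , q , e , refl , a , a∈p , m<a) =
      window-in-block p m q blocks e 1≤b m<a (inj₁ a∈p)
    long⇒anomaly : HasLongBlock b Bs → HasAnomaly b (concat Bs)
    long⇒anomaly (B , B∈Bs , long) with member-block blocks B∈Bs | ∈⇒concat-infix B∈Bs
    ... | h , t , refl , t<h | P , Q , e =
      subst (HasAnomaly b) (sym e) (block-anomaly b P Q t<h (ℕP.≤-pred long))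

  blockList-map : (f : Fin L → List (Fin L)) {hs : List (Fin L)} → AllPairs F._<_ hs →
    (∀ {h} → h ∈ hs → ∃[ t ] (f h ≡ h ∷ t × All (F._< h) t)) → BlockList (map f hs)
  blockList-map f {[]}     []                _      = []
  blockList-map f {h ∷ hs} (h<hs ∷ increasing) blocks with f h | blocks (here refl)
  ... | _ | t , refl , t<h =
    block t<h (AllP.map⁺ (All.tabulate heads-above))
      (blockList-map f increasing (blocks ∘ there))
    where
    heads-above : ∀ {h′} → h′ ∈ hs → h ⊏ f h′
    heads-above h′∈hs with blocks (there h′∈hs)
    ... | _ , block-shape , _ = subst (h ⊏_) (sym block-shape) (All.lookup h<hs h′∈hs)

module Iterates {L : ℕ} (s : Permutation′ L) where

  σ : Fin L → Fin L
  σ x = s ⟨$⟩ʳ x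

  σ-injective : ∀ {x y} → σ x ≡ σ y → x ≡ y
  σ-injective e = trans (sym (inverseˡ s)) (trans (cong (s ⟨$⟩ˡ_) e) (inverseˡ s))

  iter-suc : ∀ k x → iter s k (σ x) ≡ iter s (suc k) x
  iter-suc zero    x = refl
  iter-suc (suc k) x = cong σ (iter-suc k x)

  iter-+ : ∀ i j x → iter s (i + j) x ≡ iter s i (iter s j x)
  iter-+ zero    j x = refl
  iter-+ (suc i) j x = cong σ (iter-+ i j x)

  iter-comm : ∀ i j x → iter s i (iter s j x) ≡ iter s j (iter s i x)
  iter-comm i j x = begin
    iter s i (iter s j x) ≡⟨ sym (iter-+ i j x) ⟩
    iter s (i + j) x      ≡⟨ cong (λ n → iter s n x) (ℕP.+-comm i j) ⟩
    iter s (j + i) x      ≡⟨ iter-+ j i x ⟩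
    iter s j (iter s i x) ∎
    where open ≡-Reasoning

  iter-injective : ∀ n {x y} → iter s n x ≡ iter s n y → x ≡ y
  iter-injective zero    e = e
  iter-injective (suc n) e = iter-injective n (σ-injective e)

  -- Every point returns to itself within L steps (pigeonhole on x, σ x, …, σ^L x).
  return-time : ∀ x → ∃[ d ] (0 ℕ.< d × d ≤ L × iter s d x ≡ x)
  return-time x with FP.pigeonhole (ℕP.n<1+n L) (λ (i : Fin (suc L)) → iter s (toℕ i) x)
  ... | i , j , i<j , same = toℕ j ∸ toℕ i , ℕP.m<n⇒0<n∸m i<j ,
        ℕP.≤-trans (ℕP.m∸n≤m (toℕ j) (toℕ i)) (ℕP.≤-pred (FP.toℕ<n j)) ,
        iter-injective (toℕ i) shifted
    where
    open ≡-Reasoning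
    d = toℕ j ∸ toℕ i
    shifted : iter s (toℕ i) (iter s d x) ≡ iter s (toℕ i) x
    shifted = begin
      iter s (toℕ i) (iter s d x) ≡⟨ iter-comm (toℕ i) d x ⟩
      iter s d (iter s (toℕ i) x) ≡⟨ sym (iter-+ d (toℕ i) x) ⟩
      iter s (d + toℕ i) x        ≡⟨ cong (λ n → iter s n x) (ℕP.m∸n+n≡m (ℕP.<⇒≤ i<j)) ⟩
      iter s (toℕ j) x            ≡⟨ sym same ⟩
      iter s (toℕ i) x            ∎

  -- Every point lies on a cycle of some length, namely its least return time.
  cycle-length : ∀ x → ∃[ k ] OnCycleOfLength s x k
  cycle-length x with return-time x
  ... | d , 0<d , _ , returns with least-witness returns? d (0<d , returns)
    where
    returns? : ∀ n → Dec (0 ℕ.< n × iter s n x ≡ x)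
    returns? n with 0 ℕ.<? n | iter s n x F.≟ x
    ... | yes 0<n | yes e = yes (0<n , e)
    ... | no ¬0<n | _     = no (¬0<n ∘ proj₁)
    ... | _       | no ¬e = no (¬e ∘ proj₂)
  ... | k , (0<k , returns-k) , earlier =
    k , 0<k , returns-k , λ j 0<j j<k e → earlier j j<k (0<j , e)

  cycle-length≤L : ∀ {x k} → OnCycleOfLength s x k → k ≤ L
  cycle-length≤L {x} {k} (_ , _ , minimal) with k ℕ.≤? L | return-time x
  ... | yes k≤L | _ = k≤L
  ... | no k≰L | d , 0<d , d≤L , returns =
    ⊥-elim (minimal d 0<d (ℕP.≤-<-trans d≤L (ℕP.≰⇒> k≰L)) returns)

  onCycle-shift : ∀ {x k} → OnCycleOfLength s x k → ∀ j → OnCycleOfLength s (iter s j x) k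
  onCycle-shift {x} {k} (0<k , returns , minimal) j =
    0<k , trans (iter-comm k j x) (cong (iter s j) returns) ,
    λ i 0<i i<k e → minimal i 0<i i<k (iter-injective j (trans (iter-comm j i x) e))

  orbit-reduce : ∀ {x d} → 0 ℕ.< d → iter s d x ≡ x →
    ∀ i → ∃[ r ] (r ℕ.< d × iter s i x ≡ iter s r x)
  orbit-reduce 0<d returns zero = 0 , 0<d , refl
  orbit-reduce {x} {d} 0<d returns (suc i) with orbit-reduce 0<d returns i
  ... | r , r<d , e with ℕP.m≤n⇒m<n∨m≡n r<d
  ...   | inj₁ 1+r<d = suc r , 1+r<d , cong σ e
  ...   | inj₂ 1+r≡d = 0 , 0<d , trans (cong σ e) (trans (cong (λ n → iter s n x) 1+r≡d) returns)

  cycle-maximum : ∀ {x k} → 0 ℕ.< k → iter s k x ≡ x →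
    ∃[ j ] (∀ i → iter s i (iter s j x) F.≤ iter s j x)
  cycle-maximum {x} {k} 0<k returns = j , dominates
    where
    open Data.List.Extrema (FP.≤-totalOrder L)
    j = argmax (λ i → iter s i x) 0 (upTo k)
    dominates : ∀ i → iter s i (iter s j x) F.≤ iter s j x
    dominates i with orbit-reduce 0<k returns (i + j)
    ... | r , r<k , e = subst (F._≤ iter s j x) (trans (sym e) (iter-+ i j x))
      (All.lookup (f[xs]≤f[argmax] 0 (upTo k)) (∈-upTo⁺ r<k))

  isHead⇔ : ∀ {h} → T (isHead s h) ⇔ (∀ k → iter s k h F.≤ h)
  isHead⇔ {h} = mk⇔ largest head
    where
    returns-below : ℕ → Bool
    returns-below k = ⌊ iter s k h F.≤? h ⌋
    largest : T (isHead s h) → ∀ k → iter s k h F.≤ h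
    largest isH k with return-time h
    ... | d , 0<d , d≤L , returns with orbit-reduce 0<d returns k
    ...   | r , r<d , e = subst (F._≤ h) (sym e)
      (toWitness (All.lookup (AllP.all⁺ returns-below (upTo L) isH) (∈-upTo⁺ (ℕP.<-≤-trans r<d d≤L))))
    head : (∀ k → iter s k h F.≤ h) → T (isHead s h)
    head largest = AllP.all⁻ returns-below {xs = upTo L} (All.tabulate (λ {k} _ → fromWitness (largest k)))

  cycleFrom-avoids : ∀ h n x j → suc j ℕ.< length (cycleFrom s h n x) → iter s (suc j) x ≢ h
  cycleFrom-avoids h zero x j ()
  cycleFrom-avoids h (suc n) x j long with s ⟨$⟩ʳ x F.≟ h
  cycleFrom-avoids h (suc n) x j (s≤s ()) | yes _
  cycleFrom-avoids h (suc n) x zero     long       | no σx≢h = σx≢h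
  cycleFrom-avoids h (suc n) x (suc j) (s≤s long) | no _ =
    cycleFrom-avoids h n (σ x) j long ∘ trans (iter-suc (suc j) x)

  cycleFrom-length : ∀ h n x c → c ≤ n → (∀ j → suc j ℕ.< c → iter s (suc j) x ≢ h) →
    c ≤ length (cycleFrom s h n x)
  cycleFrom-length h n       x zero          _         _      = z≤n
  cycleFrom-length h (suc n) x (suc zero)    _         _      = s≤s z≤n
  cycleFrom-length h (suc n) x (suc (suc c)) (s≤s c≤n) avoids with s ⟨$⟩ʳ x F.≟ h
  ... | yes σx≡h = ⊥-elim (avoids 0 (s≤s (s≤s z≤n)) σx≡h)
  ... | no _ = s≤s (cycleFrom-length h n (σ x) (suc c) c≤n
        (λ j j<c → avoids (suc j) (s≤s j<c) ∘ trans (sym (iter-suc (suc j) x))))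

  cycleFrom-below : ∀ h n x → x ≢ h → (∀ j → iter s j x F.≤ h) → All (F._< h) (cycleFrom s h n x)
  cycleFrom-below h zero    x _    _     = []
  cycleFrom-below h (suc n) x x≢h below with s ⟨$⟩ʳ x F.≟ h
  ... | yes _    = FP.≤∧≢⇒< (below 0) x≢h ∷ []
  ... | no σx≢h = FP.≤∧≢⇒< (below 0) x≢h ∷
        cycleFrom-below h n (σ x) σx≢h (λ j → subst (F._≤ h) (sym (iter-suc j x)) (below (suc j)))

  cycleFrom-covers : ∀ {h k} → OnCycleOfLength s h k → k ≤ length (cycleFrom s h L h)
  cycleFrom-covers {h} {k} onCycle@(_ , _ , minimal) =
    cycleFrom-length h L h k (cycle-length≤L onCycle) (λ j j<k → minimal (suc j) (s≤s z≤n) j<k)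

module FoataWord {n : ℕ} (s : Permutation′ (suc n)) where
  open Iterates s

  heads : List (Fin (suc n))
  heads = filter (λ h → T? (isHead s h)) (allFin (suc n))

  cycleOf : Fin (suc n) → List (Fin (suc n))
  cycleOf h = cycleFrom s h (suc n) h

  head-block : ∀ {h} → T (isHead s h) → ∃[ t ] (cycleOf h ≡ h ∷ t × All (F._< h) t)
  head-block {h} isH with s ⟨$⟩ʳ h F.≟ h
  ... | yes _     = [] , refl , []
  ... | no σh≢h = _ , refl , cycleFrom-below h n (σ h) σh≢h
        (λ j → subst (F._≤ h) (sym (iter-suc j h)) (to isHead⇔ isH (suc j)))

  foata-blocks : BlockList (map cycleOf heads)
  foata-blocks = blockList-map cycleOf
    (AllPairsP.filter⁺ (λ h → T? (isHead s h)) (AllPairsP.tabulate⁺-< (λ i<j → i<j)))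
    (λ h∈heads → head-block (proj₂ (∈-filter⁻ (λ h → T? (isHead s h)) {xs = allFin (suc n)} h∈heads)))

  long-cycle⇔long-block : ∀ b →
    HasCycleOfLengthAtLeast s (suc b) ⇔ HasLongBlock b (map cycleOf heads)
  long-cycle⇔long-block b = mk⇔ cycle⇒block block⇒cycle
    where
    -- the largest element of a long cycle is a head whose block covers the cycle
    cycle⇒block : HasCycleOfLengthAtLeast s (suc b) → HasLongBlock b (map cycleOf heads)
    cycle⇒block (x , k , b<k , onCycle@(0<k , returns , _)) with cycle-maximum 0<k returns
    ... | j , largest = cycleOf (iter s j x) ,
      ∈-map⁺ cycleOf (∈-filter⁺ (λ h → T? (isHead s h)) (∈-allFin _) (from isHead⇔ largest)) ,
      ℕP.<-≤-trans b<k (cycleFrom-covers (onCycle-shift onCycle j))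
    -- the head of a long block does not return to itself within b steps
    block⇒cycle : HasLongBlock b (map cycleOf heads) → HasCycleOfLengthAtLeast s (suc b)
    block⇒cycle (B , B∈ , long) with ∈-map⁻ cycleOf B∈
    ... | h , _ , refl with cycle-length h
    ...   | suc j , onCycle@(_ , returns , _) =
      h , suc j , ℕP.≰⇒> (λ k≤b → cycleFrom-avoids h (suc n) h j (ℕP.≤-<-trans k≤b long) returns) ,
      onCycle

-- foata s is by definition the concatenation of the blocks of the heads, so the
-- two halves compose (after rewriting b + 1 as suc b).
proposition3p2 : (b L : ℕ) → 1 ≤ b → 1 ≤ L → (s : Permutation′ L) →
    HasCycleOfLengthAtLeast s (b + 1) ⇔ HasAnomaly b (foata s)
proposition3p2 b (suc n) 1≤b _ s rewrite ℕP.+-comm b 1 =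
  ⇔.trans (long-cycle⇔long-block b) (⇔.sym (anomaly⇔long-block 1≤b foata-blocks))
  where open FoataWord s
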